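{- Let $r \ge k > p > 1$ be integers. Then $$\binom{k-1}{p-1}\left(\frac{k+1}{2}\right)^{\frac{k-p}{k-1}} \le \binom{r-1}{p-1}\binom{r-1}{k-1}^{ -\frac{p-1}{k-1}} 2^{k-1}.$$ -}

-- Put b = p − 1, c = k − p and n = r − 1, so that k − 1 = b + c. Multiplying both
-- sides by (b! c!)^(b+c) turns every binomial coefficient into a falling factorial
-- n ↓ m = n!/(n − m)!, and the inequality becomes the product of two inequalities.
-- The first, (n ↓ (b+c))^b ≤ (n ↓ b)^(b+c), holds because n ↓ (b+c) = n ↓ b · (n−b) ↓ c
-- and ((n−b) ↓ c)^b ≤ (n−b)^(bc) ≤ (n ↓ b)^c. The second,
-- ((b+c)! (b+c+2))^c ≤ (c!)^(b+c) 2^((b+c)² + c), rests on x^c ≤ c! 2^(x+c)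
-- (a binomial coefficient is at most a power of two): with x = b + c when
-- b + c + 2 ≤ 2^(c+1), and with x = b, via (b+c)! ≤ 2^(b+c) b! c!, when b ≥ c + 2.
module Submission where

open import Data.Nat
open import Data.Nat.Properties
open import Data.Nat.Combinatorics
  using (_C_; nCk≡n!/k![n-k]!; k![n∸k]!∣n!; nCk+nC[k+1]≡[n+1]C[k+1])
open import Data.Nat.DivMod using (m/n*n≡m)
open import Data.Nat.Tactic.RingSolver using (solve-∀)
open import Relation.Binary.PropositionalEquality
open import Relation.Nullary using (yes; no)

^-distribʳ-* : ∀ m n o → (m * n) ^ o ≡ m ^ o * n ^ o
^-distribʳ-* m n zero    = refl
^-distribʳ-* m n (suc o) = begin
  m * n * (m * n) ^ o      ≡⟨ cong (m * n *_) (^-distribʳ-* m n o) ⟩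
  m * n * (m ^ o * n ^ o)  ≡⟨ [m*n]*[o*p]≡[m*o]*[n*p] m n (m ^ o) (n ^ o) ⟩
  m * m ^ o * (n * n ^ o)  ∎
  where open ≡-Reasoning

^-comm : ∀ m n o → (m ^ n) ^ o ≡ (m ^ o) ^ n
^-comm m n o = begin
  (m ^ n) ^ o  ≡⟨ ^-*-assoc m n o ⟩
  m ^ (n * o)  ≡⟨ cong (m ^_) (*-comm n o) ⟩
  m ^ (o * n)  ≡⟨ sym (^-*-assoc m o n) ⟩
  (m ^ o) ^ n  ∎
  where open ≡-Reasoning

infix 8 _↓_

_↓_ : ℕ → ℕ → ℕ
n ↓ zero  = 1
n ↓ suc m = n * (n ∸ 1) ↓ m

n↓m*[n∸m]!≡n! : ∀ n m → m ≤ n → n ↓ m * (n ∸ m) ! ≡ n !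
n↓m*[n∸m]!≡n! n       zero    _         = *-identityˡ (n !)
n↓m*[n∸m]!≡n! (suc n) (suc m) (s≤s m≤n) = begin
  suc n * n ↓ m * (n ∸ m) !    ≡⟨ *-assoc (suc n) (n ↓ m) _ ⟩
  suc n * (n ↓ m * (n ∸ m) !)  ≡⟨ cong (suc n *_) (n↓m*[n∸m]!≡n! n m m≤n) ⟩
  suc n * n !                  ∎
  where open ≡-Reasoning

n↓[b+c]≡n↓b*[n∸b]↓c : ∀ n b c → n ↓ (b + c) ≡ n ↓ b * (n ∸ b) ↓ c
n↓[b+c]≡n↓b*[n∸b]↓c n zero    c = sym (+-identityʳ (n ↓ c))
n↓[b+c]≡n↓b*[n∸b]↓c n (suc b) c = begin
  n * (n ∸ 1) ↓ (b + c)                     ≡⟨ cong (n *_) (n↓[b+c]≡n↓b*[n∸b]↓c (n ∸ 1) b c) ⟩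
  n * ((n ∸ 1) ↓ b * (n ∸ 1 ∸ b) ↓ c)       ≡⟨ cong (λ m → n * ((n ∸ 1) ↓ b * m ↓ c)) (∸-+-assoc n 1 b) ⟩
  n * ((n ∸ 1) ↓ b * (n ∸ suc b) ↓ c)       ≡⟨ sym (*-assoc n _ _) ⟩
  n * (n ∸ 1) ↓ b * (n ∸ suc b) ↓ c         ∎
  where open ≡-Reasoning

n↓m≤n^m : ∀ n m → n ↓ m ≤ n ^ m
n↓m≤n^m n zero    = ≤-refl
n↓m≤n^m n (suc m) = *-monoʳ-≤ n (≤-trans (n↓m≤n^m (n ∸ 1) m) (^-monoˡ-≤ m (m∸n≤m n 1)))

[n∸m]^m≤n↓m : ∀ n m → (n ∸ m) ^ m ≤ n ↓ m
[n∸m]^m≤n↓m n zero    = ≤-refl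
[n∸m]^m≤n↓m n (suc m) = *-mono-≤ (m∸n≤m n (suc m))
  (subst (λ k → k ^ m ≤ (n ∸ 1) ↓ m) (∸-+-assoc n 1 m) ([n∸m]^m≤n↓m (n ∸ 1) m))

[n↓[b+c]]^b≤[n↓b]^[b+c] : ∀ n b c → (n ↓ (b + c)) ^ b ≤ (n ↓ b) ^ (b + c)
[n↓[b+c]]^b≤[n↓b]^[b+c] n b c = begin
  (n ↓ (b + c)) ^ b                 ≡⟨ cong (_^ b) (n↓[b+c]≡n↓b*[n∸b]↓c n b c) ⟩
  (n ↓ b * (n ∸ b) ↓ c) ^ b         ≡⟨ ^-distribʳ-* (n ↓ b) _ b ⟩
  (n ↓ b) ^ b * ((n ∸ b) ↓ c) ^ b   ≤⟨ *-monoʳ-≤ ((n ↓ b) ^ b) (^-monoˡ-≤ b (n↓m≤n^m (n ∸ b) c)) ⟩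
  (n ↓ b) ^ b * ((n ∸ b) ^ c) ^ b   ≡⟨ cong ((n ↓ b) ^ b *_) (^-comm (n ∸ b) c b) ⟩
  (n ↓ b) ^ b * ((n ∸ b) ^ b) ^ c   ≤⟨ *-monoʳ-≤ ((n ↓ b) ^ b) (^-monoˡ-≤ c ([n∸m]^m≤n↓m n b)) ⟩
  (n ↓ b) ^ b * (n ↓ b) ^ c         ≡⟨ sym (^-distribˡ-+-* (n ↓ b) b c) ⟩
  (n ↓ b) ^ (b + c)                 ∎
  where open ≤-Reasoning

nCk*[k!*[n∸k]!]≡n! : ∀ {n k} → k ≤ n → (n C k) * (k ! * (n ∸ k) !) ≡ n !
nCk*[k!*[n∸k]!]≡n! {n} {k} k≤n = begin
  (n C k) * (k ! * (n ∸ k) !)                                     ≡⟨ cong (_* (k ! * (n ∸ k) !)) (nCk≡n!/k![n-k]! k≤n) ⟩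
  (n ! / (k ! * (n ∸ k) !)) {{k!*[n∸k]!≢0}} * (k ! * (n ∸ k) !)  ≡⟨ m/n*n≡m {{k!*[n∸k]!≢0}} (k![n∸k]!∣n! k≤n) ⟩
  n !                                                           ∎
  where
    open ≡-Reasoning
    k!*[n∸k]!≢0 : NonZero (k ! * (n ∸ k) !)
    k!*[n∸k]!≢0 = k !* (n ∸ k) !≢0

nCk*k!≡n↓k : ∀ {n k} → k ≤ n → (n C k) * k ! ≡ n ↓ k
nCk*k!≡n↓k {n} {k} k≤n = *-cancelʳ-≡ _ _ ((n ∸ k) !) {{(n ∸ k) !≢0}} (begin
  (n C k) * k ! * (n ∸ k) !    ≡⟨ *-assoc (n C k) (k !) _ ⟩
  (n C k) * (k ! * (n ∸ k) !)  ≡⟨ nCk*[k!*[n∸k]!]≡n! k≤n ⟩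
  n !                        ≡⟨ sym (n↓m*[n∸m]!≡n! n k k≤n) ⟩
  n ↓ k * (n ∸ k) !          ∎)
  where open ≡-Reasoning

nCk≤2^n : ∀ n k → n C k ≤ 2 ^ n
nCk≤2^n zero    zero    = ≤-refl
nCk≤2^n zero    (suc k) = z≤n
nCk≤2^n (suc n) zero    = m^n>0 2 (suc n)
nCk≤2^n (suc n) (suc k) = begin
  suc n C suc k          ≡⟨ sym (nCk+nC[k+1]≡[n+1]C[k+1] n k) ⟩
  n C k + n C suc k      ≤⟨ +-mono-≤ (nCk≤2^n n k) (nCk≤2^n n (suc k)) ⟩
  2 ^ n + 2 ^ n          ≡⟨ cong (2 ^ n +_) (sym (+-identityʳ (2 ^ n))) ⟩
  2 ^ suc n              ∎
  where open ≤-Reasoning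

[b+c]!≡[b+c]↓b*c! : ∀ b c → (b + c) ! ≡ (b + c) ↓ b * c !
[b+c]!≡[b+c]↓b*c! b c = begin
  (b + c) !                        ≡⟨ sym (n↓m*[n∸m]!≡n! (b + c) b (m≤m+n b c)) ⟩
  (b + c) ↓ b * (b + c ∸ b) !      ≡⟨ cong (λ m → (b + c) ↓ b * m !) (m+n∸m≡n b c) ⟩
  (b + c) ↓ b * c !                ∎
  where open ≡-Reasoning

[b+c]!≡[b+c]Cb*[b!*c!] : ∀ b c → (b + c) ! ≡ ((b + c) C b) * (b ! * c !)
[b+c]!≡[b+c]Cb*[b!*c!] b c = begin
  (b + c) !                              ≡⟨ sym (nCk*[k!*[n∸k]!]≡n! (m≤m+n b c)) ⟩
  ((b + c) C b) * (b ! * (b + c ∸ b) !)    ≡⟨ cong (λ m → ((b + c) C b) * (b ! * m !)) (m+n∸m≡n b c) ⟩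
  ((b + c) C b) * (b ! * c !)              ∎
  where open ≡-Reasoning

m^n≤n!*2^[m+n] : ∀ m n → m ^ n ≤ n ! * 2 ^ (m + n)
m^n≤n!*2^[m+n] m n = begin
  m ^ n                    ≡⟨ cong (_^ n) (sym (m+n∸n≡m m n)) ⟩
  (m + n ∸ n) ^ n          ≤⟨ [n∸m]^m≤n↓m (m + n) n ⟩
  (m + n) ↓ n              ≡⟨ sym (nCk*k!≡n↓k (m≤n+m n m)) ⟩
  ((m + n) C n) * n !        ≤⟨ *-monoˡ-≤ (n !) (nCk≤2^n (m + n) n) ⟩
  2 ^ (m + n) * n !        ≡⟨ *-comm (2 ^ (m + n)) (n !) ⟩
  n ! * 2 ^ (m + n)        ∎
  where open ≤-Reasoning

n!*n≤n^n : ∀ n → n ! * n ≤ n ^ n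
n!*n≤n^n zero    = z≤n
n!*n≤n^n (suc n) = begin
  suc n ! * suc n                        ≡⟨ cong (_* suc n) (sym (n↓m*[n∸m]!≡n! (suc n) n (n≤1+n n))) ⟩
  suc n ↓ n * (suc n ∸ n) ! * suc n      ≡⟨ cong (λ m → suc n ↓ n * m ! * suc n) (m+n∸n≡m 1 n) ⟩
  suc n ↓ n * 1 * suc n                  ≤⟨ *-monoˡ-≤ (suc n) (≤-trans (≤-reflexive (*-identityʳ _)) (n↓m≤n^m (suc n) n)) ⟩
  suc n ^ n * suc n                      ≡⟨ *-comm (suc n ^ n) (suc n) ⟩
  suc n ^ suc n                          ∎
  where open ≤-Reasoning

w^c≤x^[b+c]*z^[u*b+v*c] : ∀ {w x y z} b c u v →
  w ≤ y ^ b * (x * z ^ v) → y ^ c ≤ x * z ^ u → w ^ c ≤ x ^ (b + c) * z ^ (u * b + v * c)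
w^c≤x^[b+c]*z^[u*b+v*c] {w} {x} {y} {z} b c u v w≤ y^c≤ = begin
  w ^ c                                  ≤⟨ ^-monoˡ-≤ c w≤ ⟩
  (y ^ b * (x * z ^ v)) ^ c              ≡⟨ ^-distribʳ-* (y ^ b) _ c ⟩
  (y ^ b) ^ c * (x * z ^ v) ^ c          ≡⟨ cong (_* (x * z ^ v) ^ c) (^-comm y b c) ⟩
  (y ^ c) ^ b * (x * z ^ v) ^ c          ≤⟨ *-monoˡ-≤ ((x * z ^ v) ^ c) (^-monoˡ-≤ b y^c≤) ⟩
  (x * z ^ u) ^ b * (x * z ^ v) ^ c      ≡⟨ cong₂ _*_ (^-distribʳ-* x (z ^ u) b) (^-distribʳ-* x (z ^ v) c) ⟩
  x ^ b * (z ^ u) ^ b * (x ^ c * (z ^ v) ^ c)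
    ≡⟨ [m*n]*[o*p]≡[m*o]*[n*p] (x ^ b) _ (x ^ c) _ ⟩
  x ^ b * x ^ c * ((z ^ u) ^ b * (z ^ v) ^ c)
    ≡⟨ cong₂ _*_ (sym (^-distribˡ-+-* x b c)) (cong₂ _*_ (^-*-assoc z u b) (^-*-assoc z v c)) ⟩
  x ^ (b + c) * (z ^ (u * b) * z ^ (v * c))
    ≡⟨ cong (x ^ (b + c) *_) (sym (^-distribˡ-+-* z (u * b) (v * c))) ⟩
  x ^ (b + c) * z ^ (u * b + v * c)      ∎
  where open ≤-Reasoning

FactorialBound : ℕ → ℕ → Set
FactorialBound b c = ((b + c) ! * (b + c + 2)) ^ c ≤ (c !) ^ (b + c) * 2 ^ ((b + c) * (b + c) + c)

factorial-bound-small-b : ∀ b c → b + c + 2 ≤ 2 ^ suc c → FactorialBound b c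
factorial-bound-small-b b c a+2≤ = subst (λ e → (a ! * (a + 2)) ^ c ≤ (c !) ^ a * 2 ^ e) (exponent b c)
  (w^c≤x^[b+c]*z^[u*b+v*c] b c (a + c) (suc c) a!*[a+2]≤ (m^n≤n!*2^[m+n] a c))
  where
    open ≤-Reasoning
    a = b + c
    exponent : ∀ b c → (b + c + c) * b + suc c * c ≡ (b + c) * (b + c) + c
    exponent = solve-∀
    a!*[a+2]≤ : a ! * (a + 2) ≤ a ^ b * (c ! * 2 ^ suc c)
    a!*[a+2]≤ = begin
      a ! * (a + 2)               ≡⟨ cong (_* (a + 2)) ([b+c]!≡[b+c]↓b*c! b c) ⟩
      a ↓ b * c ! * (a + 2)       ≤⟨ *-mono-≤ (*-monoˡ-≤ (c !) (n↓m≤n^m a b)) a+2≤ ⟩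
      a ^ b * c ! * 2 ^ suc c     ≡⟨ *-assoc (a ^ b) (c !) _ ⟩
      a ^ b * (c ! * 2 ^ suc c)   ∎

factorial-bound-large-b : ∀ b c → c + 2 ≤ b → FactorialBound b c
factorial-bound-large-b b c c+2≤b = subst (λ e → (a ! * (a + 2)) ^ c ≤ (c !) ^ a * 2 ^ e) (exponent b c)
  (w^c≤x^[b+c]*z^[u*b+v*c] b c (b + c) (suc a) a!*[a+2]≤ (m^n≤n!*2^[m+n] b c))
  where
    open ≤-Reasoning
    a = b + c
    exponent : ∀ b c → (b + c) * b + suc (b + c) * c ≡ (b + c) * (b + c) + c
    exponent = solve-∀
    regroup : ∀ t u v w → t * (u * v) * (2 * w) ≡ u * w * (v * (2 * t))
    regroup = solve-∀
    a+2≤2b : a + 2 ≤ 2 * b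
    a+2≤2b = begin
      b + c + 2    ≡⟨ +-assoc b c 2 ⟩
      b + (c + 2)  ≤⟨ +-monoʳ-≤ b c+2≤b ⟩
      b + b        ≡⟨ cong (b +_) (sym (+-identityʳ b)) ⟩
      2 * b        ∎
    a!*[a+2]≤ : a ! * (a + 2) ≤ b ^ b * (c ! * 2 ^ suc a)
    a!*[a+2]≤ = begin
      a ! * (a + 2)                          ≡⟨ cong (_* (a + 2)) ([b+c]!≡[b+c]Cb*[b!*c!] b c) ⟩
      (a C b) * (b ! * c !) * (a + 2)          ≤⟨ *-mono-≤ (*-monoˡ-≤ (b ! * c !) (nCk≤2^n a b)) a+2≤2b ⟩
      2 ^ a * (b ! * c !) * (2 * b)          ≡⟨ regroup (2 ^ a) (b !) (c !) b ⟩
      b ! * b * (c ! * 2 ^ suc a)            ≤⟨ *-monoˡ-≤ (c ! * 2 ^ suc a) (n!*n≤n^n b) ⟩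
      b ^ b * (c ! * 2 ^ suc a)              ∎

2*n+7≤2^[3+n] : ∀ n → 2 * n + 7 ≤ 2 ^ (3 + n)
2*n+7≤2^[3+n] zero    = ≤ᵇ⇒≤ 7 8 _
2*n+7≤2^[3+n] (suc n) = begin
  2 * suc n + 7             ≡⟨ shift n ⟩
  2 * n + 7 + 2             ≤⟨ +-mono-≤ (2*n+7≤2^[3+n] n) (≤-trans (≤ᵇ⇒≤ 2 8 _) (^-monoʳ-≤ 2 (m≤m+n 3 n))) ⟩
  2 ^ (3 + n) + 2 ^ (3 + n) ≡⟨ cong (2 ^ (3 + n) +_) (sym (+-identityʳ _)) ⟩
  2 ^ (3 + suc n)           ∎
  where
    open ≤-Reasoning
    shift : ∀ n → 2 * suc n + 7 ≡ 2 * n + 7 + 2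
    shift = solve-∀

factorial-bound : ∀ b c → FactorialBound b c
factorial-bound b zero = *-mono-≤ (m^n>0 1 (b + 0)) (m^n>0 2 ((b + 0) * (b + 0) + 0))
factorial-bound b (suc c) with suc c + 2 ≤? b
... | yes c+2≤b = factorial-bound-large-b b (suc c) c+2≤b
... | no  c+2≰b = b≤c+2⇒bound b c (≤-pred (≰⇒> c+2≰b))
  where
    b≤c+2⇒bound : ∀ b c → b ≤ c + 2 → FactorialBound b (suc c)
    -- FactorialBound 2 1 is covered by neither route; the other two are as quickly computed
    b≤c+2⇒bound 0 0 _ = ≤ᵇ⇒≤ _ _ _
    b≤c+2⇒bound 1 0 _ = ≤ᵇ⇒≤ _ _ _
    b≤c+2⇒bound 2 0 _ = ≤ᵇ⇒≤ _ _ _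
    b≤c+2⇒bound (suc (suc (suc _))) 0 (s≤s (s≤s ()))
    b≤c+2⇒bound b (suc d) b≤d+3 = factorial-bound-small-b b (2 + d) (begin
      b + (2 + d) + 2          ≤⟨ +-monoˡ-≤ 2 (+-monoˡ-≤ (2 + d) b≤d+3) ⟩
      suc d + 2 + (2 + d) + 2  ≡⟨ collect d ⟩
      2 * d + 7                ≤⟨ 2*n+7≤2^[3+n] d ⟩
      2 ^ (3 + d)              ∎)
      where
        open ≤-Reasoning
        collect : ∀ d → suc d + 2 + (2 + d) + 2 ≡ 2 * d + 7
        collect = solve-∀

binomial-bound : ∀ n b c → b + c ≤ n →
  ((b + c) C b) ^ (b + c) * (b + c + 2) ^ c * (n C (b + c)) ^ b
    ≤ (n C b) ^ (b + c) * 2 ^ ((b + c) * (b + c) + c)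
binomial-bound n b c a≤n = *-cancelʳ-≤ _ _ D {{D≢0}} (begin
  X ^ a * (a + 2) ^ c * Y ^ b * D      ≡⟨ lhs ⟩
  (a ! * (a + 2)) ^ c * (n ↓ a) ^ b    ≤⟨ *-mono-≤ (factorial-bound b c) ([n↓[b+c]]^b≤[n↓b]^[b+c] n b c) ⟩
  (c !) ^ a * 2 ^ E * (n ↓ b) ^ a      ≡⟨ rhs ⟩
  Z ^ a * 2 ^ E * D                    ∎)
  where
    open ≤-Reasoning
    a = b + c
    E = a * a + c
    X = a C b
    Y = n C a
    Z = n C b
    D = (b ! * c !) ^ a
    D≢0 : NonZero D
    D≢0 = m^n≢0 (b ! * c !) a {{b !* c !≢0}}
    regroupˡ₁ : ∀ x y z d → x * y * z * d ≡ x * d * (y * z)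
    regroupˡ₁ = solve-∀
    regroupˡ₂ : ∀ x y z w → x * y * (z * w) ≡ y * z * (w * x)
    regroupˡ₂ = solve-∀
    regroupʳ : ∀ x y z w → x * y * (z * w) ≡ z * y * (w * x)
    regroupʳ = solve-∀
    lhs : X ^ a * (a + 2) ^ c * Y ^ b * D ≡ (a ! * (a + 2)) ^ c * (n ↓ a) ^ b
    lhs = begin-equality
      X ^ a * (a + 2) ^ c * Y ^ b * D              ≡⟨ regroupˡ₁ (X ^ a) ((a + 2) ^ c) (Y ^ b) D ⟩
      X ^ a * D * ((a + 2) ^ c * Y ^ b)            ≡⟨ cong (_* ((a + 2) ^ c * Y ^ b)) (sym (^-distribʳ-* X (b ! * c !) a)) ⟩
      (X * (b ! * c !)) ^ a * ((a + 2) ^ c * Y ^ b) ≡⟨ cong (λ m → m ^ a * ((a + 2) ^ c * Y ^ b)) (sym ([b+c]!≡[b+c]Cb*[b!*c!] b c)) ⟩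
      (a !) ^ (b + c) * ((a + 2) ^ c * Y ^ b)      ≡⟨ cong (_* ((a + 2) ^ c * Y ^ b)) (^-distribˡ-+-* (a !) b c) ⟩
      (a !) ^ b * (a !) ^ c * ((a + 2) ^ c * Y ^ b) ≡⟨ regroupˡ₂ ((a !) ^ b) ((a !) ^ c) ((a + 2) ^ c) (Y ^ b) ⟩
      (a !) ^ c * (a + 2) ^ c * (Y ^ b * (a !) ^ b) ≡⟨ cong₂ _*_ (sym (^-distribʳ-* (a !) (a + 2) c)) (sym (^-distribʳ-* Y (a !) b)) ⟩
      (a ! * (a + 2)) ^ c * (Y * a !) ^ b          ≡⟨ cong (λ m → (a ! * (a + 2)) ^ c * m ^ b) (nCk*k!≡n↓k a≤n) ⟩
      (a ! * (a + 2)) ^ c * (n ↓ a) ^ b            ∎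
    rhs : (c !) ^ a * 2 ^ E * (n ↓ b) ^ a ≡ Z ^ a * 2 ^ E * D
    rhs = begin-equality
      (c !) ^ a * 2 ^ E * (n ↓ b) ^ a              ≡⟨ cong (λ m → (c !) ^ a * 2 ^ E * m ^ a) (sym (nCk*k!≡n↓k (≤-trans (m≤m+n b c) a≤n))) ⟩
      (c !) ^ a * 2 ^ E * (Z * b !) ^ a            ≡⟨ cong ((c !) ^ a * 2 ^ E *_) (^-distribʳ-* Z (b !) a) ⟩
      (c !) ^ a * 2 ^ E * (Z ^ a * (b !) ^ a)      ≡⟨ regroupʳ ((c !) ^ a) (2 ^ E) (Z ^ a) ((b !) ^ a) ⟩
      Z ^ a * 2 ^ E * ((b !) ^ a * (c !) ^ a)      ≡⟨ cong (Z ^ a * 2 ^ E *_) (sym (^-distribʳ-* (b !) (c !) a)) ⟩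
      Z ^ a * 2 ^ E * D                            ∎

lemma3p10 : (r k p : ℕ) → 1 < p → p < k → k ≤ r →
    ((k ∸ 1) C (p ∸ 1)) ^ (k ∸ 1) * (k + 1) ^ (k ∸ p) * ((r ∸ 1) C (k ∸ 1)) ^ (p ∸ 1)
      ≤ ((r ∸ 1) C (p ∸ 1)) ^ (k ∸ 1) * 2 ^ ((k ∸ 1) * (k ∸ 1) + (k ∸ p))
-- 1 < p serves only to write p = suc b: the argument works for p = 1 as well.
lemma3p10 (suc n) (suc a) (suc b) _ (s≤s b<a) (s≤s a≤n) = subst Bound b+c≡a
  (subst (λ m → (a′ C b) ^ a′ * m ^ c * (n C a′) ^ b ≤ (n C b) ^ a′ * 2 ^ (a′ * a′ + c))
         (+-suc a′ 1)
         (binomial-bound n b c (subst (_≤ n) (sym b+c≡a) a≤n)))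
  where
    c = a ∸ b
    a′ = b + c
    b+c≡a : b + c ≡ a
    b+c≡a = m+[n∸m]≡n (<⇒≤ b<a)
    Bound : ℕ → Set
    Bound x = (x C b) ^ x * (suc x + 1) ^ c * (n C x) ^ b ≤ (n C b) ^ x * 2 ^ (x * x + c)
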